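{- Consider an MDSP instance with $m$ drones and let $\Delta$ be the maximum degree of the interval graph of the delivery intervals. Let $S_1,\dots,S_{m+\Delta}$ be pairwise disjoint subsets of $\mathcal{N}$, each of which is compatible, such that $U=\bigcup_{i=1}^{m+\Delta}S_i$ consists of $\sum_{i}|S_i|$ deliveries of largest density (i.e., $d_u\ge d_v$ for all $u\in U$, $v\in\mathcal{N}\setminus U$), and such that at least $m$ of the sets $S_i$ are critical. Then $\sum_{i=1}^{m+\Delta}\mathcal{P}(S_i)\ge f(m)$.
   Context: An MDSP instance consists of deliveries $\mathcal{N}=\{1,\dots,n\}$ and $m$ drones, each with battery budget $B>0$. Each delivery $j$ has a closed time interval $I_j=[t_j^L,t_j^R]$, a cost $c_j>0$ and a profit $p_j\ge0$; its density is $d_j=p_j/c_j$. Deliveries $j\ne k$ are compatible if $I_j\cap I_k=\emptyset$. A set $S$ is compatible if its elements are pairwise compatible and feasible if also $\mathcal{W}(S)=\sum_{j\in S}c_j\le B$; $\mathcal{P}(S)=\sum_{j\in S}p_j$. $f(m)$ is the maximum of $\sum_{i=1}^m\mathcal{P}(T_i)$ over pairwise disjoint feasible sets $T_1,\dots,T_m$. A set $S=\{k_1,\dots,k_l\}$ listed with $d_{k_1}\ge\dots\ge d_{k_l}$ is critical if $\mathcal{W}(S)>B$ and $\mathcal{W}(S\setminus\{k_l\})\le B$. The interval graph has vertex set $\mathcal{N}$ and an edge between $j\ne k$ iff $I_j\cap I_k\ne\emptyset$; $\Delta$ is its maximum degree.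
   Formalization: The delivery times $t_j^L$, $t_j^R$, the costs $c_j$, the profits $p_j$ and the budget $B$ of the MDSP instance are rational numbers. -}

module Defs where

open import Data.Nat as ℕ using (ℕ; zero; suc)
open import Data.Fin using (Fin; zero; suc)
open import Data.Fin.Subset using (Subset; _∈_; _∉_; _-_)
open import Data.Vec using (lookup)
open import Data.Bool using (Bool; true; false; if_then_else_)
open import Data.Product using (_×_; Σ; ∃)
open import Data.Rational using (ℚ; 0ℚ; _+_; _*_; _÷_; _≤_; _<_; Positive; NonNegative)
open import Data.Rational.Properties using (pos⇒nonZero)
open import Relation.Nullary using (¬_)
open import Relation.Binary.PropositionalEquality using (_≡_)

∑ : ∀ {k} → (Fin k → ℚ) → ℚ
∑ {zero}  f = 0ℚ
∑ {suc k} f = f zero + ∑ (λ i → f (suc i))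

-- An MDSP instance with n deliveries (indexed by Fin n) and battery budget B.
-- (The number of drones m is a separate parameter of the theorem.)
record MDSP (n : ℕ) : Set where
  field
    B     : ℚ
    B-pos : 0ℚ < B
    tL tR : Fin n → ℚ
    tL≤tR : ∀ j → tL j ≤ tR j
    c     : Fin n → ℚ
    c-pos : ∀ j → Positive (c j)
    p     : Fin n → ℚ
    p-nn  : ∀ j → NonNegative (p j)

module _ {n : ℕ} (I : MDSP n) where
  open MDSP I

  density : Fin n → ℚ
  density j = (p j ÷ c j) {{pos⇒nonZero (c j) {{c-pos j}}}}

  -- closed intervals I_j, I_k intersect iff max(tL) ≤ min(tR)
  Intersect : Fin n → Fin n → Set
  Intersect j k = (tL j ≤ tR k) × (tL k ≤ tR j)

  Compatible : Fin n → Fin n → Set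
  Compatible j k = ¬ Intersect j k

  CompatibleSet : Subset n → Set
  CompatibleSet S = ∀ j k → j ∈ S → k ∈ S → ¬ (j ≡ k) → Compatible j k

  𝒲 : Subset n → ℚ
  𝒲 S = ∑ (λ j → if lookup S j then c j else 0ℚ)

  𝒫 : Subset n → ℚ
  𝒫 S = ∑ (λ j → if lookup S j then p j else 0ℚ)

  Feasible : Subset n → Set
  Feasible S = CompatibleSet S × (𝒲 S ≤ B)

  -- S is critical: 𝒲(S) > B and, for a last element k_l of S in an
  -- ordering by non-increasing density (i.e. an element of minimum density
  -- in S), 𝒲(S ∖ {k_l}) ≤ B.
  Critical : Subset n → Set
  Critical S = (B < 𝒲 S) ×
    ∃ λ k → k ∈ S × (∀ j → j ∈ S → density k ≤ density j) × (𝒲 (S - k) ≤ B)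

  degree : Fin n → ℕ
  degree j = cnt (λ k → isEdge j k)
    where
      open import Data.Fin using (_≟_)
      open import Data.Rational using (_≤?_)
      open import Relation.Nullary using (yes; no)
      isEdge : Fin n → Fin n → Bool
      isEdge a b with a ≟ b
      ... | yes _ = false
      ... | no _ with tL a ≤? tR b | tL b ≤? tR a
      ...   | yes _ | yes _ = true
      ...   | _     | _     = false
      cnt : ∀ {k} → (Fin k → Bool) → ℕ
      cnt {zero} f = 0
      cnt {suc k} f = (if f zero then 1 else 0) ℕ.+ cnt (λ i → f (suc i))

  -- Δ : maximum degree of the interval graph (0 if n = 0)
  maxDeg : ℕ
  maxDeg = go degree
    where
      go : ∀ {k} → (Fin k → ℕ) → ℕ
      go {zero} f = 0
      go {suc k} f = f zero ℕ.⊔ go (λ i → f (suc i))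

  PairwiseDisjoint : ∀ {k} → (Fin k → Subset n) → Set
  PairwiseDisjoint {k} T = ∀ (i i' : Fin k) → ¬ (i ≡ i') → ∀ j → j ∈ T i → j ∉ T i'

{-# OPTIONS --safe #-}
-- Let U be the union of the S_i and δ ≥ 0 the largest density outside U, so that
-- p_j ≥ δ c_j on U and p_j ≤ δ c_j off U. Count every delivery j with its multiplicity
-- x_j among the T_i and y_j among the S_i: then x_j ≤ 1 ≤ y_j on U and y_j = 0 off U,
-- while Σ x_j c_j ≤ m B ≤ Σ y_j c_j because m of the S_i are critical. Adding
-- Σ (y_j − x_j)(p_j − δ c_j) ≥ 0 and δ Σ (y_j − x_j) c_j ≥ 0 gives Σ x_j p_j ≤ Σ y_j p_j,
-- which is the fractional-knapsack bound.
module Submission where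

open import Defs
open import Data.Bool using (Bool; true; false; if_then_else_)
open import Data.Fin using (Fin; zero; suc; _≟_)
open import Data.Fin.Properties using (any?; suc-injective; 0≢1+n)
open import Data.Fin.Subset using (Subset; _∈_; _∉_; ⁅_⁆)
open import Data.Fin.Subset.Properties using (_∈?_; x∈⁅y⁆⇒x≡y)
open import Data.Nat using (ℕ; zero; suc)
open import Data.Product using (_×_; ∃; _,_; proj₁; proj₂)
open import Data.Rational using (ℚ; 0ℚ; 1ℚ; _≤_; _*_; _⊔_; _-_; -_; 1/_; nonNegative)
open import Data.Rational.Properties
  using (≤-refl; ≤-trans; ≤-reflexive; <⇒≤; module ≤-Reasoning; +-*-ring; +-comm; +-identityˡ; +-identityʳ;
         +-inverseʳ; +-mono-≤; +-monoˡ-≤; +-monoʳ-≤; *-comm; *-assoc; *-identityˡ; *-identityʳ; *-zeroˡ; *-inverseˡ;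
         *-monoˡ-≤-nonNeg; *-monoʳ-≤-nonNeg; nonNegative⁻¹; nonNeg*nonNeg⇒nonNeg; pos⇒nonNeg; pos⇒nonZero;
         1/pos⇒pos; p≤p⊔q; p≤q⇒p≤r⊔q; ⊔-lub)
open import Data.Rational.Solver using (module +-*-Solver)
open import Data.Sum using (_⊎_; inj₁; inj₂)
open import Data.Vec using (lookup)
open import Data.Vec.Properties using ([]=⇒lookup; lookup⇒[]=; lookup-replicate)
open import Algebra.Bundles using (Ring)
open import Algebra.Properties.Semiring.Sum (Ring.semiring +-*-ring)
  using (sum; sum-cong-≗; sum-replicate-zero; ∑-comm; ∑-distrib-+; *-distribʳ-sum)
open import Function using (_∘_)
open import Function.Definitions using (Injective)
open import Relation.Binary.PropositionalEquality using (_≡_; _≢_; refl; sym; trans; cong)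
open import Relation.Nullary using (¬_; yes; no; contradiction)
open import Relation.Nullary.Decidable using (decidable-stable)
open import Relation.Unary using (Pred; Decidable)

private
  variable
    k n : ℕ

-- Rational addition is opened only inside this block: the statement of theorem4 uses ℕ's _+_.
module _ where
  open import Data.Rational using (_+_)
  open +-*-Solver using (solve; _:=_; _:+_; _:-_; _:*_)
  open ≤-Reasoning

  p≤p+q : ∀ p {q} → 0ℚ ≤ q → p ≤ p + q
  p≤p+q p 0≤q = ≤-trans (≤-reflexive (sym (+-identityʳ p))) (+-monoʳ-≤ p 0≤q)

  p≤q+p : ∀ p {q} → 0ℚ ≤ q → p ≤ q + p
  p≤q+p p 0≤q = ≤-trans (≤-reflexive (sym (+-identityˡ p))) (+-monoˡ-≤ p 0≤q)

  p≤q⇒0≤q-p : ∀ {p q} → p ≤ q → 0ℚ ≤ q - p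
  p≤q⇒0≤q-p {p} p≤q = ≤-trans (≤-reflexive (sym (+-inverseʳ p))) (+-monoˡ-≤ (- p) p≤q)

  +-cancelʳ-≤ : ∀ {p q} r → p + r ≤ q + r → p ≤ q
  +-cancelʳ-≤ {p} {q} r p+r≤q+r = begin
    p          ≡⟨ p+r-r≡p p r ⟨
    p + r - r  ≤⟨ +-monoˡ-≤ (- r) p+r≤q+r ⟩
    q + r - r  ≡⟨ p+r-r≡p q r ⟩
    q          ∎
    where
    p+r-r≡p : ∀ a b → a + b - b ≡ a
    p+r-r≡p = solve 2 (λ a b → a :+ b :- b := a) refl

  0≤p*q : ∀ {p q} → 0ℚ ≤ p → 0ℚ ≤ q → 0ℚ ≤ p * q
  0≤p*q {p} {q} 0≤p 0≤q =
    nonNegative⁻¹ (p * q) {{nonNeg*nonNeg⇒nonNeg p {{nonNegative 0≤p}} q {{nonNegative 0≤q}}}}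

  rearrangement : ∀ {a b c d} → a ≤ b → c ≤ d → a * d + b * c ≤ a * c + b * d
  rearrangement {a} {b} {c} {d} a≤b c≤d = begin
    a * d + b * c                      ≤⟨ p≤p+q _ (0≤p*q (p≤q⇒0≤q-p a≤b) (p≤q⇒0≤q-p c≤d)) ⟩
    a * d + b * c + (b - a) * (d - c)  ≡⟨ solve 4 (λ a b c d → a :* d :+ b :* c :+ (b :- a) :* (d :- c)
                                                           := a :* c :+ b :* d) refl a b c d ⟩
    a * c + b * d                      ∎

  ∑≡sum : (f : Fin k → ℚ) → ∑ f ≡ sum f
  ∑≡sum {zero}  f = refl
  ∑≡sum {suc k} f = cong (f zero +_) (∑≡sum (f ∘ suc))

  sum-≡0 : {f : Fin k → ℚ} → (∀ i → f i ≡ 0ℚ) → sum f ≡ 0ℚ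
  sum-≡0 {k} f≡0 = trans (sum-cong-≗ f≡0) (sum-replicate-zero k)

  sum-mono-≤ : {f g : Fin k → ℚ} → (∀ i → f i ≤ g i) → sum f ≤ sum g
  sum-mono-≤ {zero}  f≤g = ≤-refl
  sum-mono-≤ {suc k} f≤g = +-mono-≤ (f≤g zero) (sum-mono-≤ (f≤g ∘ suc))

  sum-nonneg : {f : Fin k → ℚ} → (∀ i → 0ℚ ≤ f i) → 0ℚ ≤ sum f
  sum-nonneg {k} 0≤f = ≤-trans (≤-reflexive (sym (sum-replicate-zero k))) (sum-mono-≤ 0≤f)

  -- The second hypothesis is (y j − x j) (p j − q j) ≥ 0, stated without subtraction.
  exchange-≤ : (x y p q : Fin n → ℚ)
    → (∀ j → (x j ≤ y j × q j ≤ p j) ⊎ (y j ≤ x j × p j ≤ q j))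
    → sum (λ j → x j * q j) ≤ sum (λ j → y j * q j)
    → sum (λ j → x j * p j) ≤ sum (λ j → y j * p j)
  exchange-≤ {n} x y p q similarlyOrdered xq≤yq = +-cancelʳ-≤ (sum yq) (begin
    sum xp + sum yq                    ≡⟨ ∑-distrib-+ xp yq ⟨
    sum (λ j → xp j + yq j)            ≤⟨ sum-mono-≤ pointwise ⟩
    sum (λ j → xq j + yp j)            ≡⟨ ∑-distrib-+ xq yp ⟩
    sum xq + sum yp                    ≤⟨ +-monoˡ-≤ (sum yp) xq≤yq ⟩
    sum yq + sum yp                    ≡⟨ +-comm (sum yq) (sum yp) ⟩
    sum yp + sum yq                    ∎)
    where
    xp yp xq yq : Fin n → ℚ
    xp j = x j * p j
    yp j = y j * p j
    xq j = x j * q j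
    yq j = y j * q j

    pointwise : ∀ j → xp j + yq j ≤ xq j + yp j
    pointwise j with similarlyOrdered j
    ... | inj₁ (x≤y , q≤p) = rearrangement x≤y q≤p
    ... | inj₂ (y≤x , p≤q) = begin
      xp j + yq j  ≡⟨ +-comm (xp j) (yq j) ⟩
      yq j + xp j  ≤⟨ rearrangement y≤x p≤q ⟩
      yp j + xq j  ≡⟨ +-comm (yp j) (xq j) ⟩
      xq j + yp j  ∎

  knapsack-exchange : (x y p c : Fin n → ℚ) (δ : ℚ) → 0ℚ ≤ δ
    → (∀ j → (x j ≤ y j × c j * δ ≤ p j) ⊎ (y j ≤ x j × p j ≤ c j * δ))
    → sum (λ j → x j * c j) ≤ sum (λ j → y j * c j)
    → sum (λ j → x j * p j) ≤ sum (λ j → y j * p j)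
  knapsack-exchange x y p c δ 0≤δ similarlyOrdered xc≤yc =
    exchange-≤ x y p (λ j → c j * δ) similarlyOrdered (begin
      sum (λ j → x j * (c j * δ))  ≡⟨ sum-cong-≗ (λ j → *-assoc (x j) (c j) δ) ⟨
      sum (λ j → x j * c j * δ)    ≡⟨ *-distribʳ-sum δ (λ j → x j * c j) ⟨
      sum (λ j → x j * c j) * δ    ≤⟨ *-monoʳ-≤-nonNeg δ {{nonNegative 0≤δ}} xc≤yc ⟩
      sum (λ j → y j * c j) * δ    ≡⟨ *-distribʳ-sum δ (λ j → y j * c j) ⟩
      sum (λ j → y j * c j * δ)    ≡⟨ sum-cong-≗ (λ j → *-assoc (y j) (c j) δ) ⟩
      sum (λ j → y j * (c j * δ))  ∎)

  indicator : Bool → ℚ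
  indicator b = if b then 1ℚ else 0ℚ

  indicator-nonneg : ∀ b → 0ℚ ≤ indicator b
  indicator-nonneg true  = nonNegative⁻¹ 1ℚ
  indicator-nonneg false = ≤-refl

  indicator-≡0 : ∀ {b} → b ≢ true → indicator b ≡ 0ℚ
  indicator-≡0 {true}  b≢true = contradiction refl b≢true
  indicator-≡0 {false} _      = refl

  if-else-0≡indicator* : ∀ b w → (if b then w else 0ℚ) ≡ indicator b * w
  if-else-0≡indicator* true  w = sym (*-identityˡ w)
  if-else-0≡indicator* false w = sym (*-zeroˡ w)

  sum-indicator-≥1 : (b : Fin k → Bool) (i : Fin k) → b i ≡ true → 1ℚ ≤ sum (indicator ∘ b)
  sum-indicator-≥1 b zero bi≡true rewrite bi≡true =
    p≤p+q 1ℚ (sum-nonneg (indicator-nonneg ∘ b ∘ suc))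
  sum-indicator-≥1 b (suc i) bi≡true =
    ≤-trans (sum-indicator-≥1 (b ∘ suc) i bi≡true) (p≤q+p _ (indicator-nonneg (b zero)))

  sum-indicator-≤1 : (b : Fin k → Bool) → (∀ i i′ → b i ≡ true → b i′ ≡ true → i ≡ i′)
    → sum (indicator ∘ b) ≤ 1ℚ
  sum-indicator-≤1 {zero}  b unique = nonNegative⁻¹ 1ℚ
  sum-indicator-≤1 {suc k} b unique with b zero in b-zero
  ... | true  = ≤-reflexive (trans (cong (1ℚ +_) (sum-≡0 (λ i → indicator-≡0 (0≢1+n ∘ unique zero (suc i) b-zero))))
                                   (+-identityʳ 1ℚ))
  ... | false = ≤-trans (≤-reflexive (+-identityˡ _))
                        (sum-indicator-≤1 (b ∘ suc) (λ i i′ bi bi′ → suc-injective (unique (suc i) (suc i′) bi bi′)))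

  multiplicity : (Fin k → Subset n) → Fin n → ℚ
  multiplicity A j = sum (λ i → indicator (lookup (A i) j))

  multiplicity-nonneg : (A : Fin k → Subset n) (j : Fin n) → 0ℚ ≤ multiplicity A j
  multiplicity-nonneg A j = sum-nonneg (λ i → indicator-nonneg (lookup (A i) j))

  multiplicity-≡0 : (A : Fin k → Subset n) (j : Fin n) → (∀ i → j ∉ A i) → multiplicity A j ≡ 0ℚ
  multiplicity-≡0 A j j∉A = sum-≡0 (λ i → indicator-≡0 (j∉A i ∘ lookup⇒[]= j (A i)))

  multiplicity-≥1 : (A : Fin k → Subset n) {i : Fin k} {j : Fin n} → j ∈ A i → 1ℚ ≤ multiplicity A j
  multiplicity-≥1 A {i} {j} j∈Ai = sum-indicator-≥1 (λ i → lookup (A i) j) i ([]=⇒lookup j∈Ai)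

  multiplicity-≤1 : (A : Fin k → Subset n) (j : Fin n) → (∀ i i′ → j ∈ A i → j ∈ A i′ → i ≡ i′)
    → multiplicity A j ≤ 1ℚ
  multiplicity-≤1 A j unique = sum-indicator-≤1 (λ i → lookup (A i) j)
    (λ i i′ e e′ → unique i i′ (lookup⇒[]= j (A i) e) (lookup⇒[]= j (A i′) e′))

  restrict : Subset n → (Fin n → ℚ) → Fin n → ℚ
  restrict A w j = if lookup A j then w j else 0ℚ

  sum-restrict-⁅⁆ : (a : Fin n) (w : Fin n → ℚ) → sum (restrict ⁅ a ⁆ w) ≡ w a
  sum-restrict-⁅⁆ zero    w = trans (cong (w zero +_) (sum-≡0 (λ j → cong (if_then w (suc j) else 0ℚ)
                                                                               (lookup-replicate j false))))
                                    (+-identityʳ (w zero))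
  sum-restrict-⁅⁆ (suc a) w = trans (+-identityˡ _) (sum-restrict-⁅⁆ a (w ∘ suc))

  sum-sum-restrict≡sum-multiplicity* : (A : Fin k → Subset n) (w : Fin n → ℚ)
    → sum (λ i → sum (restrict (A i) w)) ≡ sum (λ j → multiplicity A j * w j)
  sum-sum-restrict≡sum-multiplicity* A w = begin-equality
    sum (λ i → sum (restrict (A i) w))                        ≡⟨ ∑-comm (λ i → restrict (A i) w) ⟩
    sum (λ j → sum (λ i → restrict (A i) w j))                ≡⟨ sum-cong-≗ (λ j → sum-cong-≗ (λ i →
                                                                   if-else-0≡indicator* (lookup (A i) j) (w j))) ⟩
    sum (λ j → sum (λ i → indicator (lookup (A i) j) * w j))  ≡⟨ sum-cong-≗ (λ j →
                                                                   *-distribʳ-sum (w j) (λ i → indicator (lookup (A i) j))) ⟨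
    sum (λ j → multiplicity A j * w j)                        ∎

  ∑-∑-restrict≡sum-multiplicity* : (A : Fin k → Subset n) (w : Fin n → ℚ)
    → ∑ (λ i → ∑ (restrict (A i) w)) ≡ sum (λ j → multiplicity A j * w j)
  ∑-∑-restrict≡sum-multiplicity* A w = begin-equality
    ∑ (λ i → ∑ (restrict (A i) w))    ≡⟨ ∑≡sum (λ i → ∑ (restrict (A i) w)) ⟩
    sum (λ i → ∑ (restrict (A i) w))  ≡⟨ sum-cong-≗ (λ i → ∑≡sum (restrict (A i) w)) ⟩
    sum (λ i → sum (restrict (A i) w)) ≡⟨ sum-sum-restrict≡sum-multiplicity* A w ⟩
    sum (λ j → multiplicity A j * w j) ∎

  sum-∘-injective-≤ : ∀ {m} (g : Fin m → Fin n) → Injective _≡_ _≡_ g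
    → (f : Fin n → ℚ) → (∀ j → 0ℚ ≤ f j) → sum (f ∘ g) ≤ sum f
  sum-∘-injective-≤ g g-injective f 0≤f = begin
    sum (f ∘ g)                                 ≡⟨ sum-cong-≗ (λ i → sum-restrict-⁅⁆ (g i) f) ⟨
    sum (λ i → sum (restrict ⁅ g i ⁆ f))        ≡⟨ sum-sum-restrict≡sum-multiplicity* (⁅_⁆ ∘ g) f ⟩
    sum (λ j → multiplicity (⁅_⁆ ∘ g) j * f j)  ≤⟨ sum-mono-≤ (λ j → *-monoʳ-≤-nonNeg (f j) {{nonNegative (0≤f j)}}
                                                     (multiplicity-≤1 (⁅_⁆ ∘ g) j (singletons-disjoint j))) ⟩
    sum (λ j → 1ℚ * f j)                        ≡⟨ sum-cong-≗ (λ j → *-identityˡ (f j)) ⟩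
    sum f                                       ∎
    where
    singletons-disjoint : ∀ j i i′ → j ∈ ⁅ g i ⁆ → j ∈ ⁅ g i′ ⁆ → i ≡ i′
    singletons-disjoint j i i′ j∈ j∈′ = g-injective (trans (sym (x∈⁅y⁆⇒x≡y (g i) j∈)) (x∈⁅y⁆⇒x≡y (g i′) j∈′))

max₀ : (Fin k → ℚ) → ℚ
max₀ {zero}  f = 0ℚ
max₀ {suc k} f = f zero ⊔ max₀ (f ∘ suc)

≤-max₀ : (f : Fin k → ℚ) (j : Fin k) → f j ≤ max₀ f
≤-max₀ f zero    = p≤p⊔q (f zero) _
≤-max₀ f (suc j) = p≤q⇒p≤r⊔q (f zero) (≤-max₀ (f ∘ suc) j)

max₀-nonneg : (f : Fin k → ℚ) → 0ℚ ≤ max₀ f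
max₀-nonneg {zero}  f = ≤-refl
max₀-nonneg {suc k} f = p≤q⇒p≤r⊔q (f zero) (max₀-nonneg (f ∘ suc))

max₀-least : (f : Fin k → ℚ) {x : ℚ} → 0ℚ ≤ x → (∀ j → f j ≤ x) → max₀ f ≤ x
max₀-least {zero}  f 0≤x f≤x = 0≤x
max₀-least {suc k} f 0≤x f≤x = ⊔-lub (f≤x zero) (max₀-least (f ∘ suc) 0≤x (f≤x ∘ suc))

record SeparatingThreshold {ℓ} (P : Pred (Fin n) ℓ) (d : Fin n → ℚ) : Set ℓ where
  field
    δ         : ℚ
    0≤δ       : 0ℚ ≤ δ
    δ≤inside  : ∀ u → P u → δ ≤ d u
    outside≤δ : ∀ v → ¬ P v → d v ≤ δ

separating-threshold : ∀ {ℓ} {P : Pred (Fin n) ℓ} → Decidable P → (d : Fin n → ℚ) → (∀ j → 0ℚ ≤ d j)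
  → (∀ u v → P u → ¬ P v → d v ≤ d u) → SeparatingThreshold P d
separating-threshold {n} {P = P} P? d 0≤d separated = record
  { δ         = max₀ outside
  ; 0≤δ       = max₀-nonneg outside
  ; δ≤inside  = λ u Pu → max₀-least outside (0≤d u) (outside≤inside u Pu)
  ; outside≤δ = outside≤max₀
  }
  where
  outside : Fin n → ℚ
  outside v with P? v
  ... | yes _ = 0ℚ
  ... | no _  = d v

  outside≤inside : ∀ u → P u → ∀ v → outside v ≤ d u
  outside≤inside u Pu v with P? v
  ... | yes _   = 0≤d u
  ... | no ¬Pv  = separated u v Pu ¬Pv

  outside≤max₀ : ∀ v → ¬ P v → d v ≤ max₀ outside
  outside≤max₀ v ¬Pv with P? v | ≤-max₀ outside v
  ... | yes Pv | _       = contradiction Pv ¬Pv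
  ... | no _   | dv≤max₀ = dv≤max₀

module _ (I : MDSP n) where
  open MDSP I

  c-nonneg : ∀ j → 0ℚ ≤ c j
  c-nonneg j = nonNegative⁻¹ (c j) {{pos⇒nonNeg (c j) {{c-pos j}}}}

  density-nonneg : ∀ j → 0ℚ ≤ density I j
  density-nonneg j = 0≤p*q (nonNegative⁻¹ (p j) {{p-nn j}})
                           (nonNegative⁻¹ (1/ c j) {{pos⇒nonNeg (1/ c j) {{1/pos⇒pos (c j) {{c-pos j}}}}}})
    where instance _ = pos⇒nonZero (c j) {{c-pos j}}

  c*density≡p : ∀ j → c j * density I j ≡ p j
  c*density≡p j = begin-equality
    c j * (p j * 1/ c j)  ≡⟨ *-comm (c j) (p j * 1/ c j) ⟩
    p j * 1/ c j * c j    ≡⟨ *-assoc (p j) (1/ c j) (c j) ⟩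
    p j * (1/ c j * c j)  ≡⟨ cong (p j *_) (*-inverseˡ (c j)) ⟩
    p j * 1ℚ              ≡⟨ *-identityʳ (p j) ⟩
    p j                   ∎
    where
    open ≤-Reasoning
    instance _ = pos⇒nonZero (c j) {{c-pos j}}

  ≤-density⇒c*≤p : ∀ {δ j} → δ ≤ density I j → c j * δ ≤ p j
  ≤-density⇒c*≤p {j = j} δ≤d =
    ≤-trans (*-monoˡ-≤-nonNeg (c j) {{nonNegative (c-nonneg j)}} δ≤d) (≤-reflexive (c*density≡p j))

  density-≤⇒p≤c* : ∀ {δ j} → density I j ≤ δ → p j ≤ c j * δ
  density-≤⇒p≤c* {j = j} d≤δ =
    ≤-trans (≤-reflexive (sym (c*density≡p j))) (*-monoˡ-≤-nonNeg (c j) {{nonNegative (c-nonneg j)}} d≤δ)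

  𝒲-nonneg : ∀ A → 0ℚ ≤ 𝒲 I A
  𝒲-nonneg A = ≤-trans (sum-nonneg restricted-c-nonneg) (≤-reflexive (sym (∑≡sum (restrict A c))))
    where
    restricted-c-nonneg : ∀ j → 0ℚ ≤ restrict A c j
    restricted-c-nonneg j with lookup A j
    ... | true  = c-nonneg j
    ... | false = ≤-refl

  pairwiseDisjoint⇒unique : (A : Fin k → Subset n) → PairwiseDisjoint I A
    → ∀ j i i′ → j ∈ A i → j ∈ A i′ → i ≡ i′
  pairwiseDisjoint⇒unique A disjoint j i i′ j∈Ai j∈Ai′ =
    decidable-stable (i ≟ i′) (λ i≢i′ → disjoint i i′ i≢i′ j j∈Ai j∈Ai′)

  ∑𝒲-feasible≤∑𝒲-critical : ∀ {m} (S : Fin k → Subset n) (g : Fin m → Fin k) → Injective _≡_ _≡_ g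
    → (∀ i → Critical I (S (g i))) → (T : Fin m → Subset n) → (∀ i → 𝒲 I (T i) ≤ B)
    → ∑ (λ i → 𝒲 I (T i)) ≤ ∑ (λ l → 𝒲 I (S l))
  ∑𝒲-feasible≤∑𝒲-critical S g g-injective critical T withinBudget = begin
    ∑ (λ i → 𝒲 I (T i))        ≡⟨ ∑≡sum (λ i → 𝒲 I (T i)) ⟩
    sum (λ i → 𝒲 I (T i))      ≤⟨ sum-mono-≤ (λ i → ≤-trans (withinBudget i) (<⇒≤ (proj₁ (critical i)))) ⟩
    sum (λ i → 𝒲 I (S (g i)))  ≤⟨ sum-∘-injective-≤ g g-injective (λ l → 𝒲 I (S l)) (𝒲-nonneg ∘ S) ⟩
    sum (λ l → 𝒲 I (S l))      ≡⟨ ∑≡sum (λ l → 𝒲 I (S l)) ⟨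
    ∑ (λ l → 𝒲 I (S l))        ∎
    where open ≤-Reasoning

open import Data.Nat using (_+_)

theorem4 : ∀ {n : ℕ} (I : MDSP n) (m : ℕ)
    → (S : Fin (m + maxDeg I) → Subset n)
    → PairwiseDisjoint I S
    → (∀ i → CompatibleSet I (S i))
    → (∀ u v → (∃ λ i → u ∈ S i) → (∀ i → v ∉ S i) → density I v ≤ density I u)
    → (∃ λ (g : Fin m → Fin (m + maxDeg I)) → Injective _≡_ _≡_ g × (∀ i → Critical I (S (g i))))
    → ∀ (T : Fin m → Subset n) → PairwiseDisjoint I T → (∀ i → Feasible I (T i))
    → ∑ (λ i → 𝒫 I (T i)) ≤ ∑ (λ i → 𝒫 I (S i))
theorem4 {n} I m S _ _ dense (g , g-injective , critical) T disjointT feasibleT = begin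
  ∑ (λ i → 𝒫 I (T i))    ≡⟨ ∑-∑-restrict≡sum-multiplicity* T p ⟩
  sum (λ j → x j * p j)  ≤⟨ knapsack-exchange x y p c δ 0≤δ similarlyOrdered weight-bound ⟩
  sum (λ j → y j * p j)  ≡⟨ ∑-∑-restrict≡sum-multiplicity* S p ⟨
  ∑ (λ i → 𝒫 I (S i))    ∎
  where
  open MDSP I
  open ≤-Reasoning

  x y : Fin n → ℚ
  x = multiplicity T
  y = multiplicity S

  U? : Decidable (λ j → ∃ λ k → j ∈ S k)
  U? j = any? (λ k → j ∈? S k)

  open SeparatingThreshold (separating-threshold U? (density I) (density-nonneg I)
                             (λ u v u∈U v∉U → dense u v u∈U (λ k v∈Sk → v∉U (k , v∈Sk))))

  similarlyOrdered : ∀ j → (x j ≤ y j × c j * δ ≤ p j) ⊎ (y j ≤ x j × p j ≤ c j * δ)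
  similarlyOrdered j with U? j
  ... | yes j∈U@(_ , j∈Sk) =
    inj₁ ( ≤-trans (multiplicity-≤1 T j (pairwiseDisjoint⇒unique I T disjointT j)) (multiplicity-≥1 S j∈Sk)
         , ≤-density⇒c*≤p I (δ≤inside j j∈U))
  ... | no j∉U =
    inj₂ ( ≤-trans (≤-reflexive (multiplicity-≡0 S j (λ k j∈Sk → j∉U (k , j∈Sk)))) (multiplicity-nonneg T j)
         , density-≤⇒p≤c* I (outside≤δ j j∉U))

  weight-bound : sum (λ j → x j * c j) ≤ sum (λ j → y j * c j)
  weight-bound = begin
    sum (λ j → x j * c j)  ≡⟨ ∑-∑-restrict≡sum-multiplicity* T c ⟨
    ∑ (λ i → 𝒲 I (T i))    ≤⟨ ∑𝒲-feasible≤∑𝒲-critical I S g g-injective critical T (proj₂ ∘ feasibleT) ⟩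
    ∑ (λ i → 𝒲 I (S i))    ≡⟨ ∑-∑-restrict≡sum-multiplicity* S c ⟩
    sum (λ j → y j * c j)  ∎
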